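{- Let $k\ge 4$ be an integer and $n=2^k$. There are exactly $2^k\prod_{i=1}^{k-3}(2^i+1)$ BLG paths on $n$ vertices (two BLG paths being identified when they have the same edge-length vector).
   Context: Vertices $[n]=\{1,\dots,n\}$ of $K_n$; the length of edge $\{i,j\}$ is $\min\{|i-j|,n-|i-j|\}\in\{1,\dots,d\}$, $d=\lfloor n/2\rfloor$. The edge-length vector of a path records, for each $i\in[d]$, the number of its edges of length $i$. For a permutation $\phi$ of $[d]$, the $g$-sequence is $g_0^{\phi}=n$, $g_i^{\phi}=\gcd(\phi(i),g_{i-1}^{\phi})$ for $1\le i\le d$. A BLG path is a Hamiltonian path of $K_n$ that is the minimum-cost Hamiltonian path for circulant costs (edges of length $i$ cost $c_i$) with $c_{\phi(1)}<\dots<c_{\phi(d)}$ for some permutation $\phi$; its edge-length vector $t$ satisfies $t_{\phi(i)}=g_{i-1}^{\phi}-g_i^{\phi}$ for $i=1,\dots,d$. Equivalently, the BLG paths correspond to the distinct vectors $t^{\phi}$ (defined by $t^{\phi}_{\phi(i)}=g_{i-1}^{\phi}-g_i^{\phi}$) as $\phi$ ranges over permutations of $[d]$. -}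

module Defs where

open import Data.Nat using (ℕ; zero; suc; _+_; _*_; _∸_; _^_)
open import Data.Nat.GCD using (gcd)
open import Data.Fin using (Fin; zero; suc; toℕ; inject₁)
open import Data.Fin.Permutation using (Permutation′; _⟨$⟩ʳ_)
open import Data.Vec using (Vec; lookup)
open import Data.List using (List; upTo; map)
open import Data.Nat.ListAction using (product)
open import Data.Product using (∃)
open import Relation.Binary.PropositionalEquality using (_≡_)

-- Given g₀ = n and values f : Fin d → ℕ (f j = φ(j+1)),
-- gSeq n f i  (i : Fin (suc d), i.e. i ∈ {0,…,d}) is g_i, where
-- g_0 = n and g_{i} = gcd (φ(i)) (g_{i-1}).
gSeq : ℕ → {d : ℕ} → (Fin d → ℕ) → Fin (suc d) → ℕ
gSeq n f zero = n
gSeq n {suc d} f (suc i) = gSeq (gcd (f zero) n) (λ j → f (suc j)) i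

-- A permutation φ of [d] is modelled as a permutation of Fin d;
-- index j : Fin d stands for the number j+1 ∈ [d].
phiVal : {d : ℕ} → Permutation′ d → Fin d → ℕ
phiVal φ j = suc (toℕ (φ ⟨$⟩ʳ j))

g : (n : ℕ) {d : ℕ} → Permutation′ d → Fin (suc d) → ℕ
g n φ i = gSeq n (phiVal φ) i

-- An edge-length vector t ∈ ℕ^d is stored as Vec ℕ d, entry j being t_{j+1}.
-- t is the vector t^φ iff  t_{φ(i)} = g_{i-1} - g_i  for all i = 1..d
-- (0-based: index i : Fin d stands for i+1).
IsTPhi : (n : ℕ) {d : ℕ} → Permutation′ d → Vec ℕ d → Set
IsTPhi n φ t = ∀ (i : Fin _) → lookup t (φ ⟨$⟩ʳ i) ≡ g n φ (inject₁ i) ∸ g n φ (suc i)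

-- t is the edge-length vector of a BLG path on n vertices (d = ⌊n/2⌋)
IsBLGVector : (n : ℕ) {d : ℕ} → Vec ℕ d → Set
IsBLGVector n {d} t = ∃ λ (φ : Permutation′ d) → IsTPhi n φ t

prodTerm : ℕ → ℕ
prodTerm m = product (map (λ i → 2 ^ suc i + 1) (upTo m))

-- Let n = 2^k and K = k - 1, so the lengths are 1, …, 2^K.  All terms of a g-sequence are then
-- powers of two, and gcd x 2^m = 2^(min (ν x) m) for the 2-adic valuation ν; hence g^φ drops exactly
-- at the records of φ, the entries whose valuation is below that of every earlier entry.  They form
-- a chain whose valuations decrease strictly from at most K to 0, t^φ is supported exactly on it and
-- so determines it, and every chain is the record chain of a permutation listing it first.  Thus BLG
-- vectors correspond to chains.  With N_e numbers of valuation e in [2^K] (N_e = 2^(K-1-e) for e < K,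
-- N_K = 1), a chain is one of the N_0 odd numbers preceded, for each e ∈ [K], by none or one of the
-- N_e numbers of valuation e: 2^(K-1) ∏_{e=1}^{K} (N_e + 1) = 2^k ∏_{i=1}^{k-3} (2^i + 1) chains.

module Submission where

open import Defs
open import Data.Empty using (⊥-elim)
open import Data.Fin as Fin using (Fin; zero; suc; toℕ; fromℕ<; inject₁)
open import Data.Fin.Permutation as Perm
  using (Permutation; Permutation′; _⟨$⟩ʳ_; _⟨$⟩ˡ_; inverseʳ; ↔⇒≡)
open import Data.Fin.Properties as Fin using (toℕ-injective; toℕ-fromℕ<; toℕ<n)
open import Data.List as List
  using (List; []; _∷_; [_]; _++_; length; allFin; filter; upTo; cartesianProductWith)
open import Data.List.Membership.Propositional using (_∈_; _∉_; lose)
open import Data.List.Membership.Propositional.Properties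
  using ( ∈-lookup; ∈-allFin; ∈-filter⁺; ∈-filter⁻; ∈-++⁺ˡ; ∈-++⁺ʳ; ∈-++⁻; ∈-map⁺; ∈-map⁻
        ; ∈-tabulate⁺; ∈-tabulate⁻; ∈-cartesianProductWith⁺; ∈-cartesianProductWith⁻)
open import Data.List.Membership.DecPropositional as DecMembership using ()
open import Data.List.Properties
  using (length-++; length-map; length-tabulate; map-++; upTo-∷ʳ; ∷-injective)
open import Data.List.Relation.Binary.Disjoint.Propositional using (Disjoint)
open import Data.List.Relation.Unary.All as All using (All; []; _∷_)
open import Data.List.Relation.Unary.All.Properties as All using ()
open import Data.List.Relation.Unary.AllPairs using ([]; _∷_)
open import Data.List.Relation.Unary.Any using (Any; here; there)
open import Data.List.Relation.Unary.Enumerates.Setoid.Properties using (lookup-surjective)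
open import Data.List.Relation.Unary.Unique.Propositional using (Unique)
open import Data.List.Relation.Unary.Unique.Propositional.Properties
  using (++⁺; map⁺; filter⁺; allFin⁺; cartesianProductWith⁺)
open import Data.Nat
open import Data.Nat.Coprimality using (Coprime; coprime⇒gcd≡1; coprime-factors)
open import Data.Nat.Divisibility
open import Data.Nat.GCD using (gcd; gcd-zeroʳ; c*gcd[m,n]≡gcd[cm,cn])
open import Data.Nat.Induction using (<-rec)
open import Data.Nat.ListAction using (product)
open import Data.Nat.ListAction.Properties using (product-++)
open import Data.Nat.Properties
open import Data.Nat.Tactic.RingSolver using (solve-∀)
open import Data.Product as Product using (Σ; ∃; ∃₂; _×_; _,_; proj₁; proj₂)
open import Data.Sum using (_⊎_; inj₁; inj₂; [_,_]′)
open import Data.Vec as Vec using (Vec; lookup)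
open import Data.Vec.Properties using (lookup∘tabulate; tabulate∘lookup; tabulate-cong)
open import Function using (_∘_; _∘′_)
open import Function.Bundles using (_⇔_; mk⇔; mk⤖; Equivalence; Injection)
open import Function.Definitions using (Injective)
open import Function.Properties.Bijection using (⤖⇒↔)
open import Function.Properties.Inverse using (↔⇒↣)
open import Relation.Binary.PropositionalEquality as ≡
  using (_≡_; _≢_; refl; sym; trans; cong; cong₂; subst; ≢-sym; module ≡-Reasoning)
open import Relation.Nullary using (yes; no; ¬?; contradiction)
open import Relation.Unary using (Decidable)

open Equivalence using (to; from)

odd : ℕ → ℕ
odd b = suc (2 * b)

2^[1+e]*odd : ∀ e b → 2 ^ suc e * odd b ≡ 2 * (2 ^ e * odd b)
2^[1+e]*odd e b = *-assoc 2 (2 ^ e) (odd b)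

∣2∧∣odd⇒≡1 : ∀ {i} b → i ∣ 2 → i ∣ odd b → i ≡ 1
∣2∧∣odd⇒≡1 {i} b i∣2 i∣odd =
  ∣1⇒≡1 (∣m+n∣m⇒∣n (subst (i ∣_) (+-comm 1 (2 * b)) i∣odd) (∣-trans i∣2 (m∣m*n b)))

odd≢2* : ∀ b q → odd b ≢ 2 * q
odd≢2* b q eq = contradiction (∣2∧∣odd⇒≡1 b ∣-refl (divides q (trans eq (*-comm 2 q)))) λ ()

coprime-odd-pow2 : ∀ b m → Coprime (odd b) (2 ^ m)
coprime-odd-pow2 b zero    (_ , i∣1) = ∣1⇒≡1 i∣1
coprime-odd-pow2 b (suc m) (i∣odd , i∣2*2^m) =
  coprime-odd-pow2 b m (i∣odd , coprime-factors coprime-odd-2 (∣m⇒∣m*n (2 ^ m) i∣odd , i∣2*2^m))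
  where
  coprime-odd-2 : Coprime (odd b) 2
  coprime-odd-2 (j∣odd , j∣2) = ∣2∧∣odd⇒≡1 b j∣2 j∣odd

even⊎odd : ∀ n → (∃ λ h → n ≡ 2 * h) ⊎ (∃ λ h → n ≡ odd h)
even⊎odd zero = inj₁ (0 , refl)
even⊎odd (suc n) with even⊎odd n
... | inj₁ (h , refl) = inj₂ (h , refl)
... | inj₂ (h , refl) = inj₁ (suc h , cong suc (sym (+-suc h (h + 0))))

pow2*odd-decomposition : ∀ n → ∃₂ λ e b → suc n ≡ 2 ^ e * odd b
pow2*odd-decomposition = <-rec _ split
  where
  split : ∀ n → (∀ {m} → m < n → ∃₂ λ e b → suc m ≡ 2 ^ e * odd b) →
          ∃₂ λ e b → suc n ≡ 2 ^ e * odd b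
  split n rec with even⊎odd (suc n)
  ... | inj₂ (b , eq) = 0 , b , trans eq (sym (*-identityˡ (odd b)))
  ... | inj₁ (suc h , eq) with e , b , eq′ ← rec (subst (h <_) (sym (suc-injective eq)) (m<m+n h z<s)) =
    suc e , b , trans eq (trans (cong (2 *_) eq′) (sym (2^[1+e]*odd e b)))

pow2*odd-injective : ∀ e e′ b b′ → 2 ^ e * odd b ≡ 2 ^ e′ * odd b′ → e ≡ e′ × b ≡ b′
pow2*odd-injective zero zero b b′ eq =
  refl , *-cancelˡ-≡ b b′ 2 (suc-injective (begin
    odd b          ≡⟨ *-identityˡ (odd b) ⟨
    1 * odd b      ≡⟨ eq ⟩
    1 * odd b′     ≡⟨ *-identityˡ (odd b′) ⟩
    odd b′         ∎))
  where open ≡-Reasoning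
pow2*odd-injective zero (suc e′) b b′ eq =
  ⊥-elim (odd≢2* b (2 ^ e′ * odd b′)
    (trans (sym (*-identityˡ (odd b))) (trans eq (2^[1+e]*odd e′ b′))))
pow2*odd-injective (suc e) zero b b′ eq =
  ⊥-elim (odd≢2* b′ (2 ^ e * odd b)
    (trans (sym (*-identityˡ (odd b′))) (trans (sym eq) (2^[1+e]*odd e b))))
pow2*odd-injective (suc e) (suc e′) b b′ eq =
  Product.map₁ (cong suc) (pow2*odd-injective e e′ b b′ (*-cancelˡ-≡ _ _ 2
    (trans (sym (2^[1+e]*odd e b)) (trans eq (2^[1+e]*odd e′ b′)))))

pow2*odd>0 : ∀ e b → 0 < 2 ^ e * odd b
pow2*odd>0 e b = *-mono-≤ (m^n>0 2 e) (s≤s z≤n)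

gcd-pow2*odd : ∀ e b m → gcd (2 ^ e * odd b) (2 ^ m) ≡ 2 ^ (e ⊓ m)
gcd-pow2*odd zero    b m       =
  trans (cong (λ x → gcd x (2 ^ m)) (*-identityˡ (odd b))) (coprime⇒gcd≡1 (coprime-odd-pow2 b m))
gcd-pow2*odd (suc e) b zero    = gcd-zeroʳ (2 ^ suc e * odd b)
gcd-pow2*odd (suc e) b (suc m) = begin
  gcd (2 ^ suc e * odd b) (2 * 2 ^ m)   ≡⟨ cong (λ x → gcd x (2 * 2 ^ m)) (2^[1+e]*odd e b) ⟩
  gcd (2 * (2 ^ e * odd b)) (2 * 2 ^ m) ≡⟨ c*gcd[m,n]≡gcd[cm,cn] 2 (2 ^ e * odd b) (2 ^ m) ⟨
  2 * gcd (2 ^ e * odd b) (2 ^ m)       ≡⟨ cong (2 *_) (gcd-pow2*odd e b m) ⟩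
  2 * 2 ^ (e ⊓ m)                       ∎
  where open ≡-Reasoning

odd≤pow2⇔ : ∀ b K → odd b ≤ 2 ^ K ⇔ b < 2 ^ (K ∸ 1)
odd≤pow2⇔ zero    zero    = mk⇔ (λ _ → z<s) (λ _ → ≤-refl)
odd≤pow2⇔ (suc b) zero    = mk⇔ (λ { (s≤s ()) }) (λ { (s≤s ()) })
odd≤pow2⇔ b       (suc K) = mk⇔ (*-cancelˡ-< 2 b (2 ^ K)) (*-monoʳ-< 2)

pow2*odd≤pow2⇔ : ∀ e b K → 2 ^ e * odd b ≤ 2 ^ K ⇔ (e ≤ K × b < 2 ^ (K ∸ suc e))
pow2*odd≤pow2⇔ zero    b K       = mk⇔
  (λ le → z≤n , to (odd≤pow2⇔ b K) (subst (_≤ 2 ^ K) (*-identityˡ (odd b)) le))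
  (λ (_ , lt) → subst (_≤ 2 ^ K) (sym (*-identityˡ (odd b))) (from (odd≤pow2⇔ b K) lt))
pow2*odd≤pow2⇔ (suc e) b zero    = mk⇔
  (λ le → contradiction (≤-trans (*-monoʳ-≤ 2 (pow2*odd>0 e b)) (subst (_≤ 1) (2^[1+e]*odd e b) le))
                        λ { (s≤s ()) })
  (λ { (() , _) })
pow2*odd≤pow2⇔ (suc e) b (suc K) = mk⇔
  (λ le → Product.map₁ s≤s (to (pow2*odd≤pow2⇔ e b K)
            (*-cancelˡ-≤ 2 (subst (_≤ 2 * 2 ^ K) (2^[1+e]*odd e b) le))))
  (λ (e≤K , lt) → subst (_≤ 2 * 2 ^ K) (sym (2^[1+e]*odd e b))
            (*-monoʳ-≤ 2 (from (pow2*odd≤pow2⇔ e b K) (≤-pred e≤K , lt))))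

length-cartesianProductWith : ∀ {A B C : Set} (f : A → B → C) xs ys →
  length (cartesianProductWith f xs ys) ≡ length xs * length ys
length-cartesianProductWith f []       ys = refl
length-cartesianProductWith f (x ∷ xs) ys =
  trans (length-++ (List.map (f x) ys))
        (cong₂ _+_ (length-map (f x) ys) (length-cartesianProductWith f xs ys))

module _ {A B : Set} {P : A → Set} {f : A → B} where

  map⁺-injectiveOn : (∀ {x y} → P x → P y → f x ≡ f y → x ≡ y) →
                     ∀ {xs} → All P xs → Unique xs → Unique (List.map f xs)
  map⁺-injectiveOn inj []         []          = []
  map⁺-injectiveOn inj (px ∷ pxs) (x∉ ∷ xs!) =
    All.map⁺ (All.zipWith (λ (py , x≢y) → x≢y ∘ inj px py) (pxs , x∉))
    ∷ map⁺-injectiveOn inj pxs xs!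

module _ {A : Set} where

  lookup-injective : ∀ {xs : List A} → Unique xs → Injective _≡_ _≡_ (List.lookup xs)
  lookup-injective (x∉ ∷ xs!) {zero}  {zero}  _  = refl
  lookup-injective (x∉ ∷ xs!) {zero}  {suc j} eq = contradiction eq (All.lookup x∉ (∈-lookup j))
  lookup-injective (x∉ ∷ xs!) {suc i} {zero}  eq = contradiction (sym eq) (All.lookup x∉ (∈-lookup i))
  lookup-injective (x∉ ∷ xs!) {suc i} {suc j} eq = cong suc (lookup-injective xs! eq)

  tabulate-lookup∘cast : ∀ {n} (xs : List A) (eq : n ≡ length xs) →
                         List.tabulate (List.lookup xs ∘ Fin.cast eq) ≡ xs
  tabulate-lookup∘cast []       refl = refl
  tabulate-lookup∘cast (x ∷ xs) refl = cong (x ∷_) (tabulate-lookup∘cast xs refl)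

module _ {d : ℕ} where

  enumeration⇒permutation : ∀ {xs : List (Fin d)} → Unique xs → (∀ x → x ∈ xs) →
                            ∃ λ (φ : Permutation′ d) → List.tabulate (φ ⟨$⟩ʳ_) ≡ xs
  enumeration⇒permutation {xs} xs! xs-enum =
    Perm.cast-id d≡length Perm.∘ₚ lookup↔ , tabulate-lookup∘cast xs d≡length
    where
    lookup↔ : Permutation (length xs) d
    lookup↔ = ⤖⇒↔ (mk⤖ (lookup-injective xs! , lookup-surjective (≡.setoid (Fin d)) xs-enum))
    d≡length : d ≡ length xs
    d≡length = sym (↔⇒≡ lookup↔)

  extend-to-permutation : ∀ {c : List (Fin d)} → Unique c →
                          ∃₂ λ (φ : Permutation′ d) rest → List.tabulate (φ ⟨$⟩ʳ_) ≡ c ++ rest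
  extend-to-permutation {c} c! =
    let φ , φ≡c++rest = enumeration⇒permutation (++⁺ c! (filter⁺ ∉c? (allFin⁺ d)) disjoint) enum
    in φ , rest , φ≡c++rest
    where
    open DecMembership (Fin._≟_ {d}) using (_∈?_)
    ∉c? : Decidable (_∉ c)
    ∉c? x = ¬? (x ∈? c)
    rest : List (Fin d)
    rest = filter ∉c? (allFin d)
    disjoint : Disjoint c rest
    disjoint (x∈c , x∈rest) = proj₂ (∈-filter⁻ ∉c? {xs = allFin d} x∈rest) x∈c
    enum : ∀ x → x ∈ c ++ rest
    enum x with x ∈? c
    ... | yes x∈c = ∈-++⁺ˡ x∈c
    ... | no  x∉c = ∈-++⁺ʳ c (∈-filter⁺ ∉c? (∈-allFin x) x∉c)

module Chains {A : Set} (rank : A → ℕ) where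

  data Chain : ℕ → List A → Set where
    []  : Chain 0 []
    _∷_ : ∀ {m x c} → rank x < m → Chain (rank x) c → Chain m (x ∷ c)

  chain-rank< : ∀ {m c y} → Chain m c → y ∈ c → rank y < m
  chain-rank< (lt ∷ ch) (here refl)  = lt
  chain-rank< (lt ∷ ch) (there y∈c) = <-trans (chain-rank< ch y∈c) lt

  chain-unique : ∀ {m c} → Chain m c → Unique c
  chain-unique []        = []
  chain-unique (_ ∷ ch) =
    All.tabulate (λ y∈c x≡y → <-irrefl (cong rank (sym x≡y)) (chain-rank< ch y∈c))
    ∷ chain-unique ch

  ∈-tail : ∀ {x y c} → rank y < rank x → y ∈ x ∷ c → y ∈ c
  ∈-tail lt (here refl)  = contradiction lt (<-irrefl refl)
  ∈-tail lt (there y∈c) = y∈c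

  chain-heads-≡ : ∀ {x x′ c c′} → Chain (rank x) c → Chain (rank x′) c′ →
                  (∀ {y} → y ∈ x ∷ c ⇔ y ∈ x′ ∷ c′) → x ≡ x′
  chain-heads-≡ ch ch′ c∼c′ with to c∼c′ (here refl) | from c∼c′ (here refl)
  ... | here x≡x′  | _           = x≡x′
  ... | there _    | here x′≡x   = sym x′≡x
  ... | there x∈c′ | there x′∈c =
    contradiction (chain-rank< ch x′∈c) (<-asym (chain-rank< ch′ x∈c′))

  chain-≡ : ∀ {m m′ c c′} → Chain m c → Chain m′ c′ → (∀ {y} → y ∈ c ⇔ y ∈ c′) → c ≡ c′
  chain-≡ []        []          _    = refl
  chain-≡ []        (_ ∷ _)     c∼c′ with () ← from c∼c′ (here refl)
  chain-≡ (_ ∷ _)   []          c∼c′ with () ← to c∼c′ (here refl)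
  chain-≡ (_ ∷ ch) (_ ∷ ch′) c∼c′ with refl ← chain-heads-≡ ch ch′ c∼c′ =
    cong (_ ∷_) (chain-≡ ch ch′ (mk⇔
      (λ y∈c  → ∈-tail (chain-rank< ch y∈c) (to c∼c′ (there y∈c)))
      (λ y∈c′ → ∈-tail (chain-rank< ch′ y∈c′) (from c∼c′ (there y∈c′)))))

  records : ℕ → List A → List A
  records m []       = []
  records m (x ∷ xs) with rank x <? m
  ... | yes _ = x ∷ records (rank x) xs
  ... | no  _ = records m xs

  ReachesZero : ℕ → List A → Set
  ReachesZero m xs = m ≡ 0 ⊎ Any (λ y → rank y ≡ 0) xs

  records-chain : ∀ m xs → ReachesZero m xs → Chain m (records m xs)
  records-chain m []       (inj₁ refl) = []
  records-chain m (x ∷ xs) reaches0 with rank x <? m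
  ... | yes lt = lt ∷ records-chain (rank x) xs (reaches0-from-x reaches0)
    where
    reaches0-from-x : ReachesZero m (x ∷ xs) → ReachesZero (rank x) xs
    reaches0-from-x (inj₁ refl)        = contradiction lt n≮0
    reaches0-from-x (inj₂ (here x₀))   = inj₁ x₀
    reaches0-from-x (inj₂ (there xs₀)) = inj₂ xs₀
  ... | no ¬lt = records-chain m xs (reaches0-without-x reaches0)
    where
    reaches0-without-x : ReachesZero m (x ∷ xs) → ReachesZero m xs
    reaches0-without-x (inj₁ m₀)          = inj₁ m₀
    reaches0-without-x (inj₂ (here x₀))   = inj₁ (n≤0⇒n≡0 (subst (m ≤_) x₀ (≮⇒≥ ¬lt)))
    reaches0-without-x (inj₂ (there xs₀)) = inj₂ xs₀

  records-0 : ∀ xs → records 0 xs ≡ []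
  records-0 []       = refl
  records-0 (x ∷ xs) with rank x <? 0
  ... | no _ = records-0 xs

  records-++ : ∀ {m c} → Chain m c → ∀ ys → records m (c ++ ys) ≡ c
  records-++ [] ys = records-0 ys
  records-++ {m} {x ∷ c} (lt ∷ ch) ys with rank x <? m
  ... | yes _  = cong (x ∷_) (records-++ ch ys)
  ... | no ¬lt = contradiction lt ¬lt

  module Enumeration (level : ℕ → List A) (level-unique : ∀ e → Unique (level e))
                     (∈-level⇔ : ∀ {e x} → x ∈ level e ⇔ rank x ≡ e) where

    chains : ℕ → List (List A)
    chainsStartingAt : ℕ → List (List A)

    chainsStartingAt m = cartesianProductWith _∷_ (level m) (chains m)

    -- The empty chain has bound 0 only, hence chains 1 does not contain chains 0.
    chains zero          = [ [] ]
    chains (suc zero)    = chainsStartingAt 0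
    chains (suc (suc m)) = chainsStartingAt (suc m) ++ chains (suc m)

    weaken : ∀ {m c} → Chain (suc m) c → Chain (suc (suc m)) c
    weaken (lt ∷ ch) = m≤n⇒m≤1+n lt ∷ ch

    chains-sound : ∀ m {c} → c ∈ chains m → Chain m c
    chainsStartingAt-sound : ∀ m {c} → c ∈ chainsStartingAt m → Chain (suc m) c

    chains-sound zero          (here refl) = []
    chains-sound (suc zero)    c∈         = chainsStartingAt-sound 0 c∈
    chains-sound (suc (suc m)) c∈ =
      [ chainsStartingAt-sound (suc m) , weaken ∘ chains-sound (suc m) ]′
        (∈-++⁻ (chainsStartingAt (suc m)) c∈)

    chainsStartingAt-sound m c∈
      with x , c′ , x∈ , c′∈ , refl ← ∈-cartesianProductWith⁻ _∷_ (level m) (chains m) c∈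
      with refl ← to ∈-level⇔ x∈ = ≤-refl ∷ chains-sound m c′∈

    chains-complete : ∀ {m c} → Chain m c → c ∈ chains m
    ∷-complete : ∀ m {x c} → rank x < m → Chain (rank x) c → x ∷ c ∈ chains m
    chainsStartingAt-complete : ∀ {m x c} → rank x ≡ m → Chain (rank x) c →
                                x ∷ c ∈ chainsStartingAt m

    chains-complete []        = here refl
    chains-complete (lt ∷ ch) = ∷-complete _ lt ch

    ∷-complete (suc zero)    lt ch = chainsStartingAt-complete (n<1⇒n≡0 lt) ch
    ∷-complete (suc (suc m)) lt ch =
      [ (λ lt′ → ∈-++⁺ʳ (chainsStartingAt (suc m)) (∷-complete (suc m) lt′ ch))
      , (λ eq → ∈-++⁺ˡ (chainsStartingAt-complete eq ch))
      ]′ (m<1+n⇒m<n∨m≡n lt)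

    chainsStartingAt-complete refl ch =
      ∈-cartesianProductWith⁺ _∷_ (from ∈-level⇔ refl) (chains-complete ch)

    chains-unique : ∀ m → Unique (chains m)
    chainsStartingAt-unique : ∀ m → Unique (chainsStartingAt m)

    chains-unique zero          = [] ∷ []
    chains-unique (suc zero)    = chainsStartingAt-unique 0
    chains-unique (suc (suc m)) =
      ++⁺ (chainsStartingAt-unique (suc m)) (chains-unique (suc m)) disjoint
      where
      disjoint : Disjoint (chainsStartingAt (suc m)) (chains (suc m))
      disjoint (c∈s , c∈c)
        with x , _ , x∈ , _ , refl ← ∈-cartesianProductWith⁻ _∷_ (level (suc m)) _ c∈s
        with lt ∷ _ ← chains-sound (suc m) c∈c = <-irrefl (to ∈-level⇔ x∈) lt

    chainsStartingAt-unique m =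
      cartesianProductWith⁺ _∷_ ∷-injective (level-unique m) (chains-unique m)

    #chains : ℕ → ℕ
    #chains m = length (chains m)

    #chains-1 : #chains 1 ≡ length (level 0)
    #chains-1 = trans (length-cartesianProductWith _∷_ (level 0) (chains 0)) (*-identityʳ _)

    #chains-2+ : ∀ m → #chains (2 + m) ≡ length (level (suc m)) * #chains (suc m) + #chains (suc m)
    #chains-2+ m =
      trans (length-++ (chainsStartingAt (suc m)))
            (cong (_+ #chains (suc m)) (length-cartesianProductWith _∷_ (level (suc m)) (chains (suc m))))

module _ {d : ℕ} where

  val : Fin d → ℕ
  val x = suc (toℕ x)

  val-injective : ∀ {x y : Fin d} → val x ≡ val y → x ≡ y
  val-injective = toℕ-injective ∘ suc-injective

  fromVal : ∀ v → 0 < v → v ≤ d → Fin d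
  fromVal (suc v) _ v<d = fromℕ< v<d

  val-fromVal : ∀ v (v>0 : 0 < v) (v≤d : v ≤ d) → val (fromVal v v>0 v≤d) ≡ v
  val-fromVal (suc v) _ v<d = cong suc (toℕ-fromℕ< v<d)

  δ : Fin d → Fin d → ℕ → ℕ
  δ p x v with p Fin.≟ x
  ... | yes _ = v
  ... | no  _ = 0

  δ-refl : ∀ p v → δ p p v ≡ v
  δ-refl p v with p Fin.≟ p
  ... | yes _  = refl
  ... | no p≢p = contradiction refl p≢p

  δ-≢ : ∀ {p x} v → p ≢ x → δ p x v ≡ 0
  δ-≢ {p} {x} v p≢x with p Fin.≟ x
  ... | yes p≡x = contradiction p≡x p≢x
  ... | no  _   = refl

  δ-0 : ∀ p x → δ p x 0 ≡ 0
  δ-0 p x with p Fin.≟ x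
  ... | yes _ = refl
  ... | no  _ = refl

  -- tAlong G xs p is t_(val p) for the g-recursion started at G and fed the lengths val x, x ∈ xs.
  tAlong : ℕ → List (Fin d) → Fin d → ℕ
  tAlong G []       p = 0
  tAlong G (x ∷ xs) p = δ p x (G ∸ gcd (val x) G) + tAlong (gcd (val x) G) xs p

  tVec : ℕ → List (Fin d) → Vec ℕ d
  tVec G xs = Vec.tabulate (tAlong G xs)

  tAlong-∉ : ∀ G {xs p} → p ∉ xs → tAlong G xs p ≡ 0
  tAlong-∉ G {[]}     p∉ = refl
  tAlong-∉ G {x ∷ xs} p∉ = cong₂ _+_ (δ-≢ _ (p∉ ∘ here)) (tAlong-∉ _ (p∉ ∘ there))

  tAlong>0⇒∈ : ∀ G {xs p} → 0 < tAlong G xs p → p ∈ xs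
  tAlong>0⇒∈ G {xs} {p} t>0 with p ∈? xs
    where open DecMembership (Fin._≟_ {d}) using (_∈?_)
  ... | yes p∈ = p∈
  ... | no  p∉ = contradiction (tAlong-∉ G p∉) (≢-sym (<⇒≢ t>0))

  tAlong-gSeq : ∀ G {d′} (f : Fin d′ → Fin d) → Injective _≡_ _≡_ f → ∀ i →
                tAlong G (List.tabulate f) (f i) ≡
                gSeq G (val ∘ f) (inject₁ i) ∸ gSeq G (val ∘ f) (suc i)
  tAlong-gSeq G f f-inj zero =
    trans (cong₂ _+_ (δ-refl (f zero) _) (tAlong-∉ _ f0∉)) (+-identityʳ _)
    where
    f0∉ : f zero ∉ List.tabulate (f ∘ suc)
    f0∉ f0∈ with () ← f-inj (proj₂ (∈-tabulate⁻ f0∈))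
  tAlong-gSeq G f f-inj (suc i) =
    trans (cong (_+ tAlong G′ (List.tabulate (f ∘ suc)) (f (suc i))) (δ-≢ _ fi≢f0))
          (tAlong-gSeq G′ (f ∘ suc) (λ eq → Fin.suc-injective (f-inj eq)) i)
    where
    G′ : ℕ
    G′ = gcd (val (f zero)) G
    fi≢f0 : f (suc i) ≢ f zero
    fi≢f0 eq with () ← f-inj eq

  isTPhi⇔ : ∀ n (φ : Permutation′ d) t →
            IsTPhi n φ t ⇔ t ≡ tVec n (List.tabulate (φ ⟨$⟩ʳ_))
  isTPhi⇔ n φ t = mk⇔ isTPhi⇒ isTPhi⇐
    where
    φs : List (Fin d)
    φs = List.tabulate (φ ⟨$⟩ʳ_)
    drop : ∀ i → tAlong n φs (φ ⟨$⟩ʳ i) ≡ g n φ (inject₁ i) ∸ g n φ (suc i)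
    drop = tAlong-gSeq n (φ ⟨$⟩ʳ_) (Injection.injective (↔⇒↣ φ))
    isTPhi⇒ : IsTPhi n φ t → t ≡ tVec n φs
    isTPhi⇒ isTPhi = trans (sym (tabulate∘lookup t)) (tabulate-cong λ j →
      subst (λ k → lookup t k ≡ tAlong n φs k) (inverseʳ φ)
            (trans (isTPhi (φ ⟨$⟩ˡ j)) (sym (drop (φ ⟨$⟩ˡ j)))))
    isTPhi⇐ : t ≡ tVec n φs → IsTPhi n φ t
    isTPhi⇐ refl i = trans (lookup∘tabulate _ (φ ⟨$⟩ʳ i)) (drop i)

  ν : Fin d → ℕ
  ν x = proj₁ (pow2*odd-decomposition (toℕ x))

  val≡pow2*odd : ∀ x → ∃ λ b → val x ≡ 2 ^ ν x * odd b
  val≡pow2*odd x = proj₂ (pow2*odd-decomposition (toℕ x))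

  ν-unique : ∀ {x} e b → val x ≡ 2 ^ e * odd b → ν x ≡ e
  ν-unique {x} e b eq =
    let b′ , eq′ = val≡pow2*odd x in proj₁ (pow2*odd-injective (ν x) e b′ b (trans (sym eq′) eq))

  gcd-val-pow2 : ∀ x m → gcd (val x) (2 ^ m) ≡ 2 ^ (ν x ⊓ m)
  gcd-val-pow2 x m =
    let b , eq = val≡pow2*odd x in trans (cong (λ v → gcd v (2 ^ m)) eq) (gcd-pow2*odd (ν x) b m)

  open Chains ν

  tAlong-∷-< : ∀ {m x} xs p → ν x < m →
               tAlong (2 ^ m) (x ∷ xs) p ≡ δ p x (2 ^ m ∸ 2 ^ ν x) + tAlong (2 ^ ν x) xs p
  tAlong-∷-< {m} {x} _ _ lt rewrite gcd-val-pow2 x m | m≤n⇒m⊓n≡m (<⇒≤ lt) = refl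

  tAlong-∷-≥ : ∀ {m x} xs p → m ≤ ν x → tAlong (2 ^ m) (x ∷ xs) p ≡ tAlong (2 ^ m) xs p
  tAlong-∷-≥ {m} {x} xs p ge rewrite gcd-val-pow2 x m | m≥n⇒m⊓n≡n ge | n∸n≡0 (2 ^ m) =
    cong (_+ tAlong (2 ^ m) xs p) (δ-0 p x)

  tAlong-records : ∀ m xs p → tAlong (2 ^ m) xs p ≡ tAlong (2 ^ m) (records m xs) p
  tAlong-records m []       p = refl
  tAlong-records m (x ∷ xs) p with ν x <? m
  ... | yes lt = begin
    tAlong (2 ^ m) (x ∷ xs) p
      ≡⟨ tAlong-∷-< xs p lt ⟩
    δ p x (2 ^ m ∸ 2 ^ ν x) + tAlong (2 ^ ν x) xs p
      ≡⟨ cong (_ +_) (tAlong-records (ν x) xs p) ⟩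
    δ p x (2 ^ m ∸ 2 ^ ν x) + tAlong (2 ^ ν x) (records (ν x) xs) p
      ≡⟨ tAlong-∷-< (records (ν x) xs) p lt ⟨
    tAlong (2 ^ m) (x ∷ records (ν x) xs) p
      ∎
    where open ≡-Reasoning
  ... | no ¬lt = trans (tAlong-∷-≥ xs p (≮⇒≥ ¬lt)) (tAlong-records m xs p)

  ∈⇒tAlong>0 : ∀ {m c y} → Chain m c → y ∈ c → 0 < tAlong (2 ^ m) c y
  ∈⇒tAlong>0 {m} {x ∷ c} {y} (lt ∷ ch) y∈ =
    subst (0 <_) (sym (tAlong-∷-< c y lt)) (head-or-tail y∈)
    where
    head-or-tail : y ∈ x ∷ c → 0 < δ y x (2 ^ m ∸ 2 ^ ν x) + tAlong (2 ^ ν x) c y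
    head-or-tail (here refl)  = subst (λ v → 0 < v + tAlong (2 ^ ν x) c y) (sym (δ-refl y _))
      (<-≤-trans (m<n⇒0<n∸m (^-monoʳ-< 2 (s≤s (s≤s z≤n)) lt)) (m≤m+n _ _))
    head-or-tail (there y∈c) = <-≤-trans (∈⇒tAlong>0 ch y∈c) (m≤n+m _ _)

  tVec-records : ∀ m xs → tVec (2 ^ m) xs ≡ tVec (2 ^ m) (records m xs)
  tVec-records m xs = tabulate-cong (tAlong-records m xs)

  tVec-++ : ∀ {m c} → Chain m c → ∀ ys → tVec (2 ^ m) (c ++ ys) ≡ tVec (2 ^ m) c
  tVec-++ {m} {c} ch ys = trans (tVec-records m (c ++ ys)) (cong (tVec (2 ^ m)) (records-++ ch ys))

  tVec-injective : ∀ {m c c′} → Chain m c → Chain m c′ →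
                   tVec (2 ^ m) c ≡ tVec (2 ^ m) c′ → c ≡ c′
  tVec-injective {m} {c} {c′} ch ch′ eq = chain-≡ ch ch′ (mk⇔
    (λ y∈c  → tAlong>0⇒∈ _ (subst (0 <_) (tAlong-≡ _) (∈⇒tAlong>0 ch y∈c)))
    (λ y∈c′ → tAlong>0⇒∈ _ (subst (0 <_) (sym (tAlong-≡ _)) (∈⇒tAlong>0 ch′ y∈c′))))
    where
    tAlong-≡ : ∀ y → tAlong (2 ^ m) c y ≡ tAlong (2 ^ m) c′ y
    tAlong-≡ y =
      trans (sym (lookup∘tabulate _ y)) (trans (cong (λ v → lookup v y) eq) (lookup∘tabulate _ y))

prodTerm-suc : ∀ r → prodTerm (suc r) ≡ prodTerm r * (2 ^ suc r + 1)
prodTerm-suc r = begin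
  product (List.map f (upTo (suc r)))            ≡⟨ cong (product ∘′ List.map f) (upTo-∷ʳ r) ⟨
  product (List.map f (upTo r ++ r ∷ []))        ≡⟨ cong product (map-++ f (upTo r) (r ∷ [])) ⟩
  product (List.map f (upTo r) ++ f r ∷ [])      ≡⟨ product-++ (List.map f (upTo r)) (f r ∷ []) ⟩
  prodTerm r * (f r * 1)                         ≡⟨ cong (prodTerm r *_) (*-identityʳ (f r)) ⟩
  prodTerm r * f r                               ∎
  where
  open ≡-Reasoning
  f : ℕ → ℕ
  f i = 2 ^ suc i + 1

module PowerOfTwo (K : ℕ) where

  withValuation : ∀ {e} → e ≤ K → Fin (2 ^ (K ∸ suc e)) → Fin (2 ^ K)
  withValuation {e} e≤K b = fromVal (2 ^ e * odd (toℕ b)) (pow2*odd>0 e (toℕ b))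
                                    (from (pow2*odd≤pow2⇔ e (toℕ b) K) (e≤K , toℕ<n b))

  val-withValuation : ∀ {e} (e≤K : e ≤ K) b → val (withValuation e≤K b) ≡ 2 ^ e * odd (toℕ b)
  val-withValuation _ _ = val-fromVal _ _ _

  withValuation-injective : ∀ {e} (e≤K : e ≤ K) {b b′} →
                            withValuation e≤K b ≡ withValuation e≤K b′ → b ≡ b′
  withValuation-injective {e} e≤K {b} {b′} eq =
    toℕ-injective (proj₂ (pow2*odd-injective e e (toℕ b) (toℕ b′)
      (trans (sym (val-withValuation e≤K b)) (trans (cong val eq) (val-withValuation e≤K b′)))))

  level : ℕ → List (Fin (2 ^ K))
  level e with e ≤? K
  ... | yes e≤K = List.map (withValuation e≤K) (allFin _)
  ... | no  _   = []

  level-unique : ∀ e → Unique (level e)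
  level-unique e with e ≤? K
  ... | yes e≤K = map⁺ (withValuation-injective e≤K) (allFin⁺ _)
  ... | no  _   = []

  length-level : ∀ {e} → e ≤ K → length (level e) ≡ 2 ^ (K ∸ suc e)
  length-level {e} e≤K with e ≤? K
  ... | yes e≤K′ = trans (length-map (withValuation e≤K′) (allFin _)) (length-tabulate _)
  ... | no  e≰K  = contradiction e≤K e≰K

  ∈-level⇔ : ∀ {e x} → x ∈ level e ⇔ ν x ≡ e
  ∈-level⇔ {e} {x} = mk⇔ sound complete
    where
    sound : x ∈ level e → ν x ≡ e
    sound x∈ with e ≤? K
    ... | yes e≤K with b , _ , refl ← ∈-map⁻ (withValuation e≤K) x∈ =
      ν-unique e (toℕ b) (val-withValuation e≤K b)
    complete : ν x ≡ e → x ∈ level e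
    complete refl with b , val≡ ← val≡pow2*odd x
      with ν≤K , b< ← to (pow2*odd≤pow2⇔ (ν x) b K) (subst (_≤ 2 ^ K) val≡ (toℕ<n x))
      with ν x ≤? K
    ... | no  ν≰K = contradiction ν≤K ν≰K
    ... | yes ν≤K′ = subst (_∈ List.map (withValuation ν≤K′) (allFin _)) (sym x≡)
                           (∈-map⁺ (withValuation ν≤K′) (∈-allFin (fromℕ< b<)))
      where
      x≡ : x ≡ withValuation ν≤K′ (fromℕ< b<)
      x≡ = val-injective (trans val≡ (sym (trans (val-withValuation ν≤K′ (fromℕ< b<))
                                                  (cong (λ z → 2 ^ ν x * odd z) (toℕ-fromℕ< b<)))))

  open Chains (ν {2 ^ K})
  open Enumeration level level-unique ∈-level⇔ public

  #chains-step : ∀ m → suc m ≤ K → #chains (2 + m) ≡ (2 ^ (K ∸ (2 + m)) + 1) * #chains (suc m)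
  #chains-step m sm≤K = begin
    #chains (2 + m)                                            ≡⟨ #chains-2+ m ⟩
    length (level (suc m)) * #chains (suc m) + #chains (suc m)
      ≡⟨ cong (λ l → l * #chains (suc m) + #chains (suc m)) (length-level sm≤K) ⟩
    2 ^ (K ∸ (2 + m)) * #chains (suc m) + #chains (suc m)
      ≡⟨ a*l+l≡[a+1]*l (2 ^ (K ∸ (2 + m))) (#chains (suc m)) ⟩
    (2 ^ (K ∸ (2 + m)) + 1) * #chains (suc m)
      ∎
    where
    open ≡-Reasoning
    a*l+l≡[a+1]*l : ∀ a l → a * l + l ≡ (a + 1) * l
    a*l+l≡[a+1]*l = solve-∀

  blgVectors : List (Vec ℕ (2 ^ K))
  blgVectors = List.map (tVec (2 ^ suc K)) (chains (suc K))

  blgVectors-unique : Unique blgVectors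
  blgVectors-unique =
    map⁺-injectiveOn tVec-injective (All.tabulate (chains-sound (suc K))) (chains-unique (suc K))

  ∈-blgVectors⇔ : ∀ {t} → t ∈ blgVectors ⇔ IsBLGVector (2 ^ suc K) t
  ∈-blgVectors⇔ {t} = mk⇔ sound complete
    where
    sound : t ∈ blgVectors → IsBLGVector (2 ^ suc K) t
    sound t∈ with c , c∈ , refl ← ∈-map⁻ (tVec (2 ^ suc K)) t∈ =
      let ch = chains-sound (suc K) c∈
          φ , rest , φs≡c++rest = extend-to-permutation (chain-unique ch)
      in φ , from (isTPhi⇔ (2 ^ suc K) φ _)
                  (sym (trans (cong (tVec (2 ^ suc K)) φs≡c++rest) (tVec-++ ch rest)))
    complete : IsBLGVector (2 ^ suc K) t → t ∈ blgVectors
    complete (φ , isTPhi) = subst (_∈ blgVectors) (sym t≡)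
      (∈-map⁺ (tVec (2 ^ suc K)) (chains-complete (records-chain (suc K) φs (inj₂ φs-reaches-0))))
      where
      φs : List (Fin (2 ^ K))
      φs = List.tabulate (φ ⟨$⟩ʳ_)
      t≡ : t ≡ tVec (2 ^ suc K) (records (suc K) φs)
      t≡ = trans (to (isTPhi⇔ (2 ^ suc K) φ t) isTPhi) (tVec-records (suc K) φs)
      one : Fin (2 ^ K)
      one = fromVal 1 z<s (m^n>0 2 K)
      φs-reaches-0 : Any (λ y → ν y ≡ 0) φs
      φs-reaches-0 = lose (subst (_∈ φs) (inverseʳ φ) (∈-tabulate⁺ (φ ⟨$⟩ˡ one)))
                          (ν-unique 0 0 (val-fromVal 1 z<s (m^n>0 2 K)))

module _ (s : ℕ) where

  open PowerOfTwo (2 + s)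
  open ≡-Reasoning

  -- #chains (m + 1) = 2^(s+1) ∏_{j=r+1}^{s} (2^j + 1), and prodTerm r supplies the missing factors.
  #chains-invariant : ∀ m r → m + r ≡ s → #chains (suc m) * prodTerm r ≡ 2 ^ suc s * prodTerm s
  #chains-invariant zero    r refl = cong (_* prodTerm r) (trans #chains-1 (length-level z≤n))
  #chains-invariant (suc m) r m+r≡s = begin
    #chains (2 + m) * prodTerm r
      ≡⟨ cong (_* prodTerm r) (#chains-step m sm≤2+s) ⟩
    (2 ^ (s ∸ m) + 1) * #chains (suc m) * prodTerm r
      ≡⟨ cong (λ j → (2 ^ j + 1) * #chains (suc m) * prodTerm r) s∸m≡1+r ⟩
    (2 ^ suc r + 1) * #chains (suc m) * prodTerm r
      ≡⟨ rearrange (2 ^ suc r + 1) (#chains (suc m)) (prodTerm r) ⟩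
    #chains (suc m) * (prodTerm r * (2 ^ suc r + 1))
      ≡⟨ cong (#chains (suc m) *_) (prodTerm-suc r) ⟨
    #chains (suc m) * prodTerm (suc r)
      ≡⟨ #chains-invariant m (suc r) (trans (+-suc m r) m+r≡s) ⟩
    2 ^ suc s * prodTerm s
      ∎
    where
    sm≤2+s : suc m ≤ 2 + s
    sm≤2+s = ≤-trans (subst (suc m ≤_) m+r≡s (m≤m+n (suc m) r)) (m≤n+m s 2)
    s∸m≡1+r : s ∸ m ≡ suc r
    s∸m≡1+r = trans (cong (_∸ m) (trans (sym m+r≡s) (sym (+-suc m r)))) (m+n∸m≡n m (suc r))
    rearrange : ∀ a l p → a * l * p ≡ l * (p * a)
    rearrange = solve-∀

  #chains-all : #chains (3 + s) ≡ 2 ^ (3 + s) * prodTerm s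
  #chains-all = begin
    #chains (3 + s)
      ≡⟨ #chains-step (suc s) ≤-refl ⟩
    (2 ^ (s ∸ suc s) + 1) * #chains (2 + s)
      ≡⟨ cong (λ j → (2 ^ j + 1) * #chains (2 + s)) (m≤n⇒m∸n≡0 (n≤1+n s)) ⟩
    2 * #chains (2 + s)
      ≡⟨ cong (2 *_) (#chains-step s (n≤1+n (suc s))) ⟩
    2 * ((2 ^ (s ∸ s) + 1) * #chains (1 + s))
      ≡⟨ cong (λ j → 2 * ((2 ^ j + 1) * #chains (1 + s))) (n∸n≡0 s) ⟩
    2 * (2 * #chains (1 + s))
      ≡⟨ cong (λ l → 2 * (2 * l)) (*-identityʳ (#chains (1 + s))) ⟨
    2 * (2 * (#chains (1 + s) * prodTerm 0))
      ≡⟨ cong (λ l → 2 * (2 * l)) (#chains-invariant s 0 (+-identityʳ s)) ⟩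
    2 * (2 * (2 ^ suc s * prodTerm s))
      ≡⟨ reassociate (2 ^ suc s) (prodTerm s) ⟩
    2 ^ (3 + s) * prodTerm s
      ∎
    where
    reassociate : ∀ x p → 2 * (2 * (x * p)) ≡ 2 * (2 * x) * p
    reassociate = solve-∀

  -- Stated for every d equal to 2^(2+s) so that it applies at the length ⌊ 2^(3+s) /2⌋.
  blgVectors-count : ∀ {d} → 2 ^ (2 + s) ≡ d →
    Σ (List (Vec ℕ d)) λ L →
      Unique L ×
      ((t : Vec ℕ d) → (t ∈ L) ⇔ IsBLGVector (2 ^ (3 + s)) t) ×
      length L ≡ 2 ^ (3 + s) * prodTerm s
  blgVectors-count refl = blgVectors , blgVectors-unique , (λ _ → ∈-blgVectors⇔) ,
                          trans (length-map _ (chains (3 + s))) #chains-all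

mainTheorem9 : (k : ℕ) → 4 ≤ k →
    Σ (List (Vec ℕ ⌊ 2 ^ k /2⌋)) (λ L →
      Unique L ×
      ((t : Vec ℕ ⌊ 2 ^ k /2⌋) → (t ∈ L) ⇔ IsBLGVector (2 ^ k) t) ×
      length L ≡ 2 ^ k * prodTerm (k ∸ 3))
mainTheorem9 (suc (suc (suc (suc s)))) (s≤s (s≤s (s≤s (s≤s _)))) = blgVectors-count (suc s) (n≡⌊2*n/2⌋ _)
  where
  n≡⌊2*n/2⌋ : ∀ n → n ≡ ⌊ 2 * n /2⌋
  n≡⌊2*n/2⌋ n = trans (n≡⌊n+n/2⌋ n) (cong (λ m → ⌊ n + m /2⌋) (sym (+-identityʳ n)))
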